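{- Let $n = 2^k p$, where $p$ is an odd prime and $k$ is a natural number, be a strongly $2$-near perfect number, and suppose $a$ is an integer with $0 \le a \le k$ such that $$p = \frac{2^{k+1} - 2^a - 1}{1 + 2^{k-a}}.$$ Then $k = a + 2$, the omitted divisors are $d_1 = 2^a$ and $d_2 = 4p$ (that is, $\sigma(n) = 2n + 2^a + 4p$), $p = \dfrac{2^{a+3} - 2^a - 1}{5}$, and $a \equiv 3 \pmod 4$.
   Context: $\sigma(n)$ denotes the sum of the positive divisors of $n$. A positive integer $n$ is called strongly $2$-near perfect if there is a positive divisor $d$ of $n$ with $d \ne n/d$ such that $\sigma(n) = 2n + d + \frac{n}{d}$; the divisors $d$ and $n/d$ are then called the omitted divisors. -}

module Defs where

open import Data.Nat using (ℕ; zero; suc; _+_; _*_)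
open import Data.Nat.Divisibility using (_∣_; _∣?_)
open import Data.List using (List; filter; upTo; map)
open import Data.Nat.ListAction using (sum)
open import Data.Product using (Σ; _×_; _,_)
open import Relation.Binary.PropositionalEquality using (_≡_; _≢_)

σ : ℕ → ℕ
σ n = sum (filter (_∣? n) (map suc (upTo n)))

OmittedDivisors : ℕ → ℕ → ℕ → Set
OmittedDivisors n d e = (d * e ≡ n) × (d ≢ e) × (σ n ≡ 2 * n + d + e)

Strongly2NearPerfect : ℕ → Set
Strongly2NearPerfect n = Σ ℕ λ d → Σ ℕ λ e → OmittedDivisors n d e

-- Every divisor of 2^k p is 2^i or 2^i p, so σ(2^k p) = (2^(k+1) - 1)(1 + p), and omitted
-- divisors d, e satisfy d + e + 1 + p = 2^(k+1).  Writing d = 2^i, e = 2^j p with i + j = k, this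
-- is the equation of the hypothesis (with i = a), and multiplying out gives
-- 2^(i+1) (1 + 2^j) = p (1 + 2^j) + 3·2^i + 1, so 1 + 2^j divides 3·2^i + 1.  As 2^j ≡ -1
-- modulo 1 + 2^j, lowering the exponent of 3·2^i ± 1 by j flips the sign; once it is below j,
-- size alone leaves only 3·2 - 1 = 1 + 2^2.  Hence j = 2, the number of sign flips gives
-- i ≡ 3 (mod 4), and comparing with the hypothesis gives i = a.

module Submission where

open import Data.List using (List; []; _∷_; _++_; map; filter; upTo; downFrom)
open import Data.List.Membership.Propositional using (_∈_)
open import Data.List.Membership.Propositional.Properties
  using (∈-map⁺; ∈-map⁻; ∈-downFrom⁺; ∈-downFrom⁻; ∈-upTo⁺; ∈-filter⁺; ∈-filter⁻; ∈-++⁺ˡ; ∈-++⁺ʳ; ∈-++⁻)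
open import Data.List.Membership.Propositional.Properties.WithK using (unique∧set⇒bag)
open import Data.List.Relation.Binary.BagAndSetEquality using (∼bag⇒↭)
open import Data.List.Relation.Unary.Unique.Propositional using (Unique)
import Data.List.Relation.Unary.Unique.Propositional.Properties as Unique
open import Data.Nat
  using (ℕ; zero; suc; _+_; _*_; _∸_; _^_; _≤_; _<_; _%_; _<?_; z≤n; s≤s; NonZero; ≢-nonZero⁻¹; >-nonZero⁻¹)
open import Data.Nat.Coprimality using (Coprime; coprime-divisor)
open import Data.Nat.Divisibility
open import Data.Nat.DivMod using ([m+kn]%n≡m%n)
open import Data.Nat.Induction using (<-rec)
open import Data.Nat.ListAction using (sum)
open import Data.Nat.ListAction.Properties using (sum-++; sum-↭)
open import Data.Nat.Primality
  using (Prime; euclidsLemma; prime⇒irreducible; prime⇒nonZero; ¬prime[1]; irreducible[2])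
open import Data.Nat.Properties
open import Algebra.Properties.CommutativeSemigroup *-commutativeSemigroup using (x∙yz≈y∙xz; xy∙z≈xz∙y)
open import Data.Nat.Tactic.RingSolver using (solve-∀)
open import Data.Product using (_×_; _,_; proj₁; proj₂; ∃-syntax; ∃₂)
open import Data.Sum using (_⊎_; inj₁; inj₂)
import Data.Sum as Sum
open import Function.Bundles using (mk⇔)
open import Relation.Binary.Definitions using (tri<; tri≈; tri>)
open import Relation.Binary.PropositionalEquality
open import Relation.Nullary using (¬_; yes; no; contradiction)

open import Defs

2^-injective : ∀ {m n} → 2 ^ m ≡ 2 ^ n → m ≡ n
2^-injective {m} {n} 2^m≡2^n with <-cmp m n
... | tri< m<n _ _ = contradiction 2^m≡2^n (<⇒≢ (^-monoʳ-< 2 (s≤s (s≤s z≤n)) m<n))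
... | tri≈ _ m≡n _ = m≡n
... | tri> _ _ n<m = contradiction 2^m≡2^n (>⇒≢ (^-monoʳ-< 2 (s≤s (s≤s z≤n)) n<m))

2^k≡2^i*2^[k∸i] : ∀ {i k} → i ≤ k → 2 ^ k ≡ 2 ^ i * 2 ^ (k ∸ i)
2^k≡2^i*2^[k∸i] {i} {k} i≤k = trans (cong (2 ^_) (sym (m+[n∸m]≡n i≤k))) (^-distribˡ-+-* 2 i (k ∸ i))

2^i∣2^k : ∀ {i k} → i ≤ k → 2 ^ i ∣ 2 ^ k
2^i∣2^k {i} {k} i≤k = divides (2 ^ (k ∸ i)) (trans (2^k≡2^i*2^[k∸i] i≤k) (*-comm (2 ^ i) _))

2^n≢3 : ∀ n → 2 ^ n ≢ 3
2^n≢3 0 ()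
2^n≢3 1 ()
2^n≢3 (suc (suc n)) = even≢odd (2 * 2 ^ n) 1

prime∣2^n⇒≡2 : ∀ {p} n → Prime p → p ∣ 2 ^ n → p ≡ 2
prime∣2^n⇒≡2 zero    pr p∣1 = contradiction (subst Prime (∣1⇒≡1 p∣1) pr) ¬prime[1]
prime∣2^n⇒≡2 (suc n) pr p∣2^[1+n] with euclidsLemma 2 (2 ^ n) pr p∣2^[1+n]
... | inj₂ p∣2^n = prime∣2^n⇒≡2 n pr p∣2^n
... | inj₁ p∣2 with irreducible[2] p∣2
...   | inj₁ p≡1 = contradiction (subst Prime p≡1 pr) ¬prime[1]
...   | inj₂ p≡2 = p≡2

2∤⇒coprime : ∀ {x} → ¬ 2 ∣ x → Coprime x 2
2∤⇒coprime 2∤x (d∣x , d∣2) with irreducible[2] d∣2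
... | inj₁ d≡1 = d≡1
... | inj₂ refl = contradiction d∣x 2∤x

∣2^k*p⇒≡2^i∨≡2^i*p : ∀ {p x} k → Prime p → x ∣ 2 ^ k * p → ∃[ i ] i ≤ k × (x ≡ 2 ^ i ⊎ x ≡ 2 ^ i * p)
∣2^k*p⇒≡2^i∨≡2^i*p {p} zero pr x∣p with prime⇒irreducible pr (subst (_ ∣_) (*-identityˡ p) x∣p)
... | inj₁ x≡1 = 0 , z≤n , inj₁ x≡1
... | inj₂ x≡p = 0 , z≤n , inj₂ (trans x≡p (sym (*-identityˡ p)))
∣2^k*p⇒≡2^i∨≡2^i*p {p} {x} (suc k) pr x∣2^[1+k]*p with 2 ∣? x
... | no 2∤x
  with i , i≤k , shape ← ∣2^k*p⇒≡2^i∨≡2^i*p k pr (coprime-divisor (2∤⇒coprime 2∤x)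
                                          (subst (x ∣_) (*-assoc 2 (2 ^ k) p) x∣2^[1+k]*p))
  = i , m≤n⇒m≤1+n i≤k , shape
... | yes (divides y refl)
  with i , i≤k , shape ← ∣2^k*p⇒≡2^i∨≡2^i*p k pr (*-cancelˡ-∣ 2
                            (subst₂ _∣_ (*-comm y 2) (*-assoc 2 (2 ^ k) p) x∣2^[1+k]*p))
  = suc i , s≤s i≤k
  , Sum.map double (λ y≡2^i*p → trans (double y≡2^i*p) (sym (*-assoc 2 (2 ^ i) p))) shape
  where
  double : ∀ {z} → y ≡ z → y * 2 ≡ 2 * z
  double refl = *-comm y 2

complementary-divisors : ∀ {k p d e} → Prime p → d * e ≡ 2 ^ k * p →
  ∃₂ λ i j → i + j ≡ k × (d ≡ 2 ^ i × e ≡ 2 ^ j * p ⊎ d ≡ 2 ^ j * p × e ≡ 2 ^ i)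
complementary-divisors {k} {p} {d} {e} pr d*e≡2^k*p
  with ∣2^k*p⇒≡2^i∨≡2^i*p k pr (divides e (trans (sym d*e≡2^k*p) (*-comm d e)))
... | i , i≤k , inj₁ refl = i , k ∸ i , m+[n∸m]≡n i≤k , inj₁ (refl , e≡2^[k∸i]*p)
  where
  instance
    2^i≢0 : NonZero (2 ^ i)
    2^i≢0 = m^n≢0 2 i
  e≡2^[k∸i]*p : e ≡ 2 ^ (k ∸ i) * p
  e≡2^[k∸i]*p = *-cancelˡ-≡ e _ (2 ^ i) (begin
    2 ^ i * e                  ≡⟨ d*e≡2^k*p ⟩
    2 ^ k * p                  ≡⟨ cong (_* p) (2^k≡2^i*2^[k∸i] i≤k) ⟩
    2 ^ i * 2 ^ (k ∸ i) * p    ≡⟨ *-assoc (2 ^ i) _ p ⟩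
    2 ^ i * (2 ^ (k ∸ i) * p)  ∎)
    where open ≡-Reasoning
... | i , i≤k , inj₂ refl = k ∸ i , i , m∸n+n≡m i≤k , inj₂ (refl , e≡2^[k∸i])
  where
  instance
    2^i*p≢0 : NonZero (2 ^ i * p)
    2^i*p≢0 = m*n≢0 (2 ^ i) p {{m^n≢0 2 i}} {{prime⇒nonZero pr}}
  e≡2^[k∸i] : e ≡ 2 ^ (k ∸ i)
  e≡2^[k∸i] = *-cancelˡ-≡ e _ (2 ^ i * p) (begin
    2 ^ i * p * e              ≡⟨ d*e≡2^k*p ⟩
    2 ^ k * p                  ≡⟨ cong (_* p) (2^k≡2^i*2^[k∸i] i≤k) ⟩
    2 ^ i * 2 ^ (k ∸ i) * p    ≡⟨ xy∙z≈xz∙y (2 ^ i) _ p ⟩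
    2 ^ i * p * 2 ^ (k ∸ i)    ∎)
    where open ≡-Reasoning

σ≡sum : ∀ {n} .{{_ : NonZero n}} xs → Unique xs →
        (∀ {x} → x ∈ xs → x ∣ n) → (∀ {x} → x ∣ n → x ∈ xs) → σ n ≡ sum xs
σ≡sum {n} xs xs-unique ∈⇒∣ ∣⇒∈ =
  sum-↭ (∼bag⇒↭ (unique∧set⇒bag divisors-unique xs-unique
    (mk⇔ (λ x∈ → ∣⇒∈ (proj₂ (∈-filter⁻ (_∣? n) {xs = map suc (upTo n)} x∈)))
         (λ x∈ → ∣⇒∈divisors (∈⇒∣ x∈)))))
  where
  divisors-unique : Unique (filter (_∣? n) (map suc (upTo n)))
  divisors-unique = Unique.filter⁺ (_∣? n) (Unique.map⁺ suc-injective (Unique.upTo⁺ n))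

  ∣⇒∈divisors : ∀ {x} → x ∣ n → x ∈ filter (_∣? n) (map suc (upTo n))
  ∣⇒∈divisors {zero}  0∣n = contradiction (0∣⇒≡0 0∣n) (≢-nonZero⁻¹ n)
  ∣⇒∈divisors {suc y} x∣n = ∈-filter⁺ (_∣? n) (∈-map⁺ suc (∈-upTo⁺ (∣⇒≤ x∣n))) x∣n

powersOf2 : ℕ → List ℕ
powersOf2 n = map (2 ^_) (downFrom n)

sum-powersOf2 : ∀ n → sum (powersOf2 n) + 1 ≡ 2 ^ n
sum-powersOf2 zero    = refl
sum-powersOf2 (suc n) = begin
  2 ^ n + sum (powersOf2 n) + 1    ≡⟨ +-assoc (2 ^ n) _ 1 ⟩
  2 ^ n + (sum (powersOf2 n) + 1)  ≡⟨ cong (2 ^ n +_) (sum-powersOf2 n) ⟩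
  2 ^ n + 2 ^ n                    ≡⟨ cong (2 ^ n +_) (+-identityʳ (2 ^ n)) ⟨
  2 * 2 ^ n                        ∎
  where open ≡-Reasoning

sum-map-*ʳ : ∀ p xs → sum (map (_* p) xs) ≡ sum xs * p
sum-map-*ʳ p []       = refl
sum-map-*ʳ p (x ∷ xs) = trans (cong (x * p +_) (sum-map-*ʳ p xs)) (sym (*-distribʳ-+ p x (sum xs)))

∈-powersOf2⁻ : ∀ {n x} → x ∈ powersOf2 n → ∃[ i ] i < n × x ≡ 2 ^ i
∈-powersOf2⁻ x∈ with i , i∈ , x≡2^i ← ∈-map⁻ (2 ^_) x∈ = i , ∈-downFrom⁻ i∈ , x≡2^i

divisorsOf2^k*p : ℕ → ℕ → List ℕ
divisorsOf2^k*p k p = powersOf2 (suc k) ++ map (_* p) (powersOf2 (suc k))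

OmittedPairEquation : ℕ → ℕ → ℕ → Set
OmittedPairEquation p i j = 2 ^ i + 2 ^ j * p + 1 + p ≡ 2 ^ suc (i + j)

module _ {k p : ℕ} (p-prime : Prime p) (p≢2 : p ≢ 2) where

  private instance
    p≢0 : NonZero p
    p≢0 = prime⇒nonZero p-prime

  divisorsOf2^k*p-unique : Unique (divisorsOf2^k*p k p)
  divisorsOf2^k*p-unique =
    Unique.++⁺ powers-unique (Unique.map⁺ (*-cancelʳ-≡ _ _ p) powers-unique) disjoint
    where
    powers-unique : Unique (powersOf2 (suc k))
    powers-unique = Unique.map⁺ 2^-injective (Unique.downFrom⁺ (suc k))
    disjoint : ∀ {v} → ¬ (v ∈ powersOf2 (suc k) × v ∈ map (_* p) (powersOf2 (suc k)))
    disjoint (v∈ , v∈ₚ)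
      with i , _ , refl ← ∈-powersOf2⁻ v∈
      with w , w∈ , 2^i≡w*p ← ∈-map⁻ (_* p) v∈ₚ
      with j , _ , refl ← ∈-powersOf2⁻ w∈
      = p≢2 (prime∣2^n⇒≡2 i p-prime (divides (2 ^ j) 2^i≡w*p))

  ∈-divisorsOf2^k*p⇒∣ : ∀ {x} → x ∈ divisorsOf2^k*p k p → x ∣ 2 ^ k * p
  ∈-divisorsOf2^k*p⇒∣ x∈ with ∈-++⁻ (powersOf2 (suc k)) x∈
  ... | inj₁ x∈₁
    with i , s≤s i≤k , refl ← ∈-powersOf2⁻ x∈₁
    = ∣-trans (2^i∣2^k i≤k) (m∣m*n {2 ^ k} p)
  ... | inj₂ x∈₂
    with w , w∈ , refl ← ∈-map⁻ (_* p) {xs = powersOf2 (suc k)} x∈₂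
    with i , s≤s i≤k , refl ← ∈-powersOf2⁻ w∈
    = *-monoˡ-∣ p (2^i∣2^k i≤k)

  ∣⇒∈-divisorsOf2^k*p : ∀ {x} → x ∣ 2 ^ k * p → x ∈ divisorsOf2^k*p k p
  ∣⇒∈-divisorsOf2^k*p x∣ with ∣2^k*p⇒≡2^i∨≡2^i*p k p-prime x∣
  ... | i , i≤k , inj₁ refl = ∈-++⁺ˡ (∈-map⁺ (2 ^_) (∈-downFrom⁺ (s≤s i≤k)))
  ... | i , i≤k , inj₂ refl =
    ∈-++⁺ʳ (powersOf2 (suc k)) (∈-map⁺ (_* p) (∈-map⁺ (2 ^_) (∈-downFrom⁺ (s≤s i≤k))))

  σ[2^k*p]+1+p≡2^[1+k]*[1+p] : σ (2 ^ k * p) + (1 + p) ≡ 2 ^ suc k * (1 + p)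
  σ[2^k*p]+1+p≡2^[1+k]*[1+p] = begin
    σ (2 ^ k * p) + (1 + p)  ≡⟨ cong (_+ (1 + p)) σ≡S+S*p ⟩
    S + S * p + (1 + p)      ≡⟨ rearrange S p ⟩
    (S + 1) * (1 + p)        ≡⟨ cong (_* (1 + p)) (sum-powersOf2 (suc k)) ⟩
    2 ^ suc k * (1 + p)      ∎
    where
    open ≡-Reasoning
    S : ℕ
    S = sum (powersOf2 (suc k))
    instance
      2^k*p≢0 : NonZero (2 ^ k * p)
      2^k*p≢0 = m*n≢0 (2 ^ k) p {{m^n≢0 2 k}}
    σ≡S+S*p : σ (2 ^ k * p) ≡ S + S * p
    σ≡S+S*p = begin
      σ (2 ^ k * p)                             ≡⟨ σ≡sum (divisorsOf2^k*p k p) divisorsOf2^k*p-unique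
                                                       ∈-divisorsOf2^k*p⇒∣ ∣⇒∈-divisorsOf2^k*p ⟩
      sum (divisorsOf2^k*p k p)                 ≡⟨ sum-++ (powersOf2 (suc k)) _ ⟩
      S + sum (map (_* p) (powersOf2 (suc k)))  ≡⟨ cong (S +_) (sum-map-*ʳ p (powersOf2 (suc k))) ⟩
      S + S * p                                 ∎
    rearrange : ∀ s p → s + s * p + (1 + p) ≡ (s + 1) * (1 + p)
    rearrange = solve-∀

  omitted⇒d+e+1+p≡2^[1+k] : ∀ {d e} → OmittedDivisors (2 ^ k * p) d e → d + e + 1 + p ≡ 2 ^ suc k
  omitted⇒d+e+1+p≡2^[1+k] {d} {e} (_ , _ , σ≡2n+d+e) = +-cancelˡ-≡ (2 * (2 ^ k * p)) _ _ (begin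
    2 * (2 ^ k * p) + (d + e + 1 + p)  ≡⟨ regroup (2 * (2 ^ k * p)) d e p ⟩
    2 * (2 ^ k * p) + d + e + (1 + p)  ≡⟨ cong (_+ (1 + p)) σ≡2n+d+e ⟨
    σ (2 ^ k * p) + (1 + p)            ≡⟨ σ[2^k*p]+1+p≡2^[1+k]*[1+p] ⟩
    2 ^ suc k * (1 + p)                ≡⟨ expand (2 ^ k) p ⟩
    2 * (2 ^ k * p) + 2 ^ suc k        ∎)
    where
    open ≡-Reasoning
    regroup : ∀ m d e p → m + (d + e + 1 + p) ≡ m + d + e + (1 + p)
    regroup = solve-∀
    expand : ∀ u p → 2 * u * (1 + p) ≡ 2 * (u * p) + 2 * u
    expand = solve-∀

  omitted⇒omittedPair : ∀ {d e} → OmittedDivisors (2 ^ k * p) d e →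
    ∃₂ λ i j → i + j ≡ k × OmittedPairEquation p i j
             × (d ≡ 2 ^ i × e ≡ 2 ^ j * p ⊎ d ≡ 2 ^ j * p × e ≡ 2 ^ i)
  omitted⇒omittedPair {d} {e} omitted@(d*e≡n , _)
    with i , j , i+j≡k , shape ← complementary-divisors p-prime d*e≡n
    = i , j , i+j≡k , equation shape , shape
    where
    d+e+1+p≡2^[1+i+j] : d + e + 1 + p ≡ 2 ^ suc (i + j)
    d+e+1+p≡2^[1+i+j] =
      subst (λ m → d + e + 1 + p ≡ 2 ^ suc m) (sym i+j≡k) (omitted⇒d+e+1+p≡2^[1+k] omitted)
    equation : d ≡ 2 ^ i × e ≡ 2 ^ j * p ⊎ d ≡ 2 ^ j * p × e ≡ 2 ^ i → OmittedPairEquation p i j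
    equation (inj₁ (d≡2^i , e≡2^j*p)) =
      trans (sym (cong₂ (λ x y → x + y + 1 + p) d≡2^i e≡2^j*p)) d+e+1+p≡2^[1+i+j]
    equation (inj₂ (d≡2^j*p , e≡2^i)) =
      trans (cong (λ x → x + 1 + p) (+-comm (2 ^ i) (2 ^ j * p)))
            (trans (sym (cong₂ (λ x y → x + y + 1 + p) d≡2^j*p e≡2^i)) d+e+1+p≡2^[1+i+j])

m∣n∧0<n<2*m⇒n≡m : ∀ {m n} → m ∣ n → 0 < n → n < 2 * m → n ≡ m
m∣n∧0<n<2*m⇒n≡m     (divides 0 refl)             () _
m∣n∧0<n<2*m⇒n≡m {m} (divides 1 refl)             _  _    = +-identityʳ m
m∣n∧0<n<2*m⇒n≡m {m} (divides (suc (suc q)) refl) _  n<2m =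
  contradiction n<2m (≤⇒≯ (+-monoʳ-≤ m (+-monoʳ-≤ m z≤n)))

1+v∣v*x+1⇒1+v∣x∸1 : ∀ v x → 1 + v ∣ v * x + 1 → 1 + v ∣ x ∸ 1
1+v∣v*x+1⇒1+v∣x∸1 v zero    _ = (1 + v) ∣0
1+v∣v*x+1⇒1+v∣x∸1 v (suc y) 1+v∣v*x+1 =
  ∣m+n∣m⇒∣n (subst (1 + v ∣_) (expand v y) (n∣m*n (suc y))) 1+v∣v*x+1
  where
  expand : ∀ v y → suc y * (1 + v) ≡ v * suc y + 1 + y
  expand = solve-∀

1+v∣v*x∸1⇒1+v∣x+1 : ∀ v x → 1 ≤ v * x → 1 + v ∣ v * x ∸ 1 → 1 + v ∣ x + 1
1+v∣v*x∸1⇒1+v∣x+1 v x 1≤v*x 1+v∣v*x∸1 =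
  ∣m+n∣m⇒∣n (subst (1 + v ∣_) split (n∣m*n x)) 1+v∣v*x∸1
  where
  open ≡-Reasoning
  expand : ∀ x v → x * (1 + v) ≡ v * x + x
  expand = solve-∀
  regroup : ∀ w x → w + 1 + x ≡ w + (x + 1)
  regroup = solve-∀
  split : x * (1 + v) ≡ v * x ∸ 1 + (x + 1)
  split = begin
    x * (1 + v)            ≡⟨ expand x v ⟩
    v * x + x              ≡⟨ cong (_+ x) (m∸n+n≡m 1≤v*x) ⟨
    v * x ∸ 1 + 1 + x      ≡⟨ regroup (v * x ∸ 1) x ⟩
    v * x ∸ 1 + (x + 1)    ∎

2≤3*2^b : ∀ b → 2 ≤ 3 * 2 ^ b
2≤3*2^b b = *-mono-≤ {2} {3} (s≤s (s≤s z≤n)) (m^n>0 2 b)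

3*2^b+1<2*[1+2^j] : ∀ {b j} → b < j → 3 * 2 ^ b + 1 < 2 * (1 + 2 ^ j)
3*2^b+1<2*[1+2^j] {b} {j} b<j = begin-strict
  3 * 2 ^ b + 1        <⟨ s≤s (+-monoˡ-≤ 1 (*-monoˡ-≤ (2 ^ b) (n≤1+n 3))) ⟩
  suc (4 * 2 ^ b + 1)  ≡⟨ regroup (2 ^ b) ⟩
  2 * (1 + 2 ^ suc b)  ≤⟨ *-monoʳ-≤ 2 (+-monoʳ-≤ 1 (^-monoʳ-≤ 2 b<j)) ⟩
  2 * (1 + 2 ^ j)      ∎
  where
  open ≤-Reasoning
  regroup : ∀ u → suc (4 * u + 1) ≡ 2 * (1 + 2 * u)
  regroup = solve-∀

1+2^j∤3*2^b+1 : ∀ {b j} → b < j → ¬ (1 + 2 ^ j ∣ 3 * 2 ^ b + 1)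
1+2^j∤3*2^b+1 {b} {j} b<j 1+2^j∣3*2^b+1 = 2^n≢3 (j ∸ b) (*-cancelʳ-≡ _ 3 (2 ^ b) {{m^n≢0 2 b}} (begin
  2 ^ (j ∸ b) * 2 ^ b  ≡⟨ ^-distribˡ-+-* 2 (j ∸ b) b ⟨
  2 ^ (j ∸ b + b)      ≡⟨ cong (2 ^_) (m∸n+n≡m (<⇒≤ b<j)) ⟩
  2 ^ j                ≡⟨ +-cancelʳ-≡ 1 _ _ (trans (+-comm (2 ^ j) 1) (sym 3*2^b+1≡1+2^j)) ⟩
  3 * 2 ^ b            ∎))
  where
  open ≡-Reasoning
  3*2^b+1≡1+2^j : 3 * 2 ^ b + 1 ≡ 1 + 2 ^ j
  3*2^b+1≡1+2^j = m∣n∧0<n<2*m⇒n≡m 1+2^j∣3*2^b+1 (m≤n+m 1 _) (3*2^b+1<2*[1+2^j] b<j)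

3*2^b≡1+2^j⇒b≡0∧j≡1 : ∀ {b j} → 3 * 2 ^ b ≡ 1 + 2 ^ j → b ≡ 0 × j ≡ 1
3*2^b≡1+2^j⇒b≡0∧j≡1 {zero}  {j}     3≡1+2^j = refl , 2^-injective {j} {1} (sym (suc-injective 3≡1+2^j))
3*2^b≡1+2^j⇒b≡0∧j≡1 {suc b} {zero}  6*2^b≡2 =
  contradiction (m*n≡1⇒m≡1 3 (2 ^ b) (*-cancelˡ-≡ _ 1 2 (trans (x∙yz≈y∙xz 2 3 (2 ^ b)) 6*2^b≡2))) λ ()
3*2^b≡1+2^j⇒b≡0∧j≡1 {suc b} {suc j} 6*2^b≡1+2^[1+j] =
  contradiction (trans (x∙yz≈y∙xz 2 3 (2 ^ b)) 6*2^b≡1+2^[1+j]) (even≢odd (3 * 2 ^ b) (2 ^ j))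

3*2^b≡2+2^j⇒b≡1∧j≡2 : ∀ {b j} → 0 < j → 3 * 2 ^ b ≡ 2 + 2 ^ j → b ≡ 1 × j ≡ 2
3*2^b≡2+2^j⇒b≡1∧j≡2 {zero}  {suc j} _ 3≡2+2^[1+j] =
  contradiction (sym (suc-injective (suc-injective 3≡2+2^[1+j]))) (even≢odd (2 ^ j) 0)
3*2^b≡2+2^j⇒b≡1∧j≡2 {suc b} {suc j} _ 6*2^b≡2+2^[1+j]
  with b≡0 , j≡1 ← 3*2^b≡1+2^j⇒b≡0∧j≡1 (*-cancelˡ-≡ _ _ 2
                       (trans (x∙yz≈y∙xz 2 3 (2 ^ b))
                       (trans 6*2^b≡2+2^[1+j] (sym (*-distribˡ-+ 2 1 (2 ^ j))))))
  = cong suc b≡0 , cong suc j≡1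

1+2^j∣3*2^b∸1⇒b≡1∧j≡2 : ∀ {b j} → b < j → 1 + 2 ^ j ∣ 3 * 2 ^ b ∸ 1 → b ≡ 1 × j ≡ 2
1+2^j∣3*2^b∸1⇒b≡1∧j≡2 {b} {j} b<j 1+2^j∣3*2^b∸1 = 3*2^b≡2+2^j⇒b≡1∧j≡2 (≤-<-trans z≤n b<j) (begin
  3 * 2 ^ b          ≡⟨ m∸n+n≡m (<⇒≤ (2≤3*2^b b)) ⟨
  3 * 2 ^ b ∸ 1 + 1  ≡⟨ cong (_+ 1) 3*2^b∸1≡1+2^j ⟩
  1 + 2 ^ j + 1      ≡⟨ +-comm (1 + 2 ^ j) 1 ⟩
  2 + 2 ^ j          ∎)
  where
  open ≡-Reasoning
  3*2^b∸1<2*[1+2^j] : 3 * 2 ^ b ∸ 1 < 2 * (1 + 2 ^ j)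
  3*2^b∸1<2*[1+2^j] = ≤-<-trans (m∸n≤m _ 1) (≤-<-trans (m≤m+n _ 1) (3*2^b+1<2*[1+2^j] b<j))
  3*2^b∸1≡1+2^j : 3 * 2 ^ b ∸ 1 ≡ 1 + 2 ^ j
  3*2^b∸1≡1+2^j = m∣n∧0<n<2*m⇒n≡m 1+2^j∣3*2^b∸1 (m<n⇒0<n∸m (2≤3*2^b b)) 3*2^b∸1<2*[1+2^j]

Pinned : ℕ → ℕ → Set
Pinned j b = (1 + 2 ^ j ∣ 3 * 2 ^ b + 1 → j ≡ 2 × ∃[ t ] b ≡ 3 + t * 4)
           × (1 + 2 ^ j ∣ 3 * 2 ^ b ∸ 1 → j ≡ 2 × ∃[ t ] b ≡ 1 + t * 4)

pinned-base : ∀ {j b} → b < j → Pinned j b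
pinned-base b<j = (λ 1+2^j∣3*2^b+1 → contradiction 1+2^j∣3*2^b+1 (1+2^j∤3*2^b+1 b<j))
                , (λ 1+2^j∣3*2^b∸1 →
                     let b≡1 , j≡2 = 1+2^j∣3*2^b∸1⇒b≡1∧j≡2 b<j 1+2^j∣3*2^b∸1 in j≡2 , 0 , b≡1)

pinned-step : ∀ {j c} → Pinned j c → Pinned j (j + c)
pinned-step {j} {c} (pinned⁺ , pinned⁻) = pinned⁺′ , pinned⁻′
  where
  3*2^[j+c]≡2^j*[3*2^c] : 3 * 2 ^ (j + c) ≡ 2 ^ j * (3 * 2 ^ c)
  3*2^[j+c]≡2^j*[3*2^c] = trans (cong (3 *_) (^-distribˡ-+-* 2 j c)) (x∙yz≈y∙xz 3 (2 ^ j) (2 ^ c))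
  1≤2^j*[3*2^c] : 1 ≤ 2 ^ j * (3 * 2 ^ c)
  1≤2^j*[3*2^c] = *-mono-≤ (m^n>0 2 j) (<⇒≤ (2≤3*2^b c))

  pinned⁺′ : 1 + 2 ^ j ∣ 3 * 2 ^ (j + c) + 1 → j ≡ 2 × ∃[ t ] j + c ≡ 3 + t * 4
  pinned⁺′ 1+2^j∣3*2^b+1
    with j≡2 , t , c≡1+t*4 ← pinned⁻ (1+v∣v*x+1⇒1+v∣x∸1 (2 ^ j) (3 * 2 ^ c)
                               (subst (λ y → 1 + 2 ^ j ∣ y + 1) 3*2^[j+c]≡2^j*[3*2^c] 1+2^j∣3*2^b+1))
    = j≡2 , t , cong₂ _+_ j≡2 c≡1+t*4

  pinned⁻′ : 1 + 2 ^ j ∣ 3 * 2 ^ (j + c) ∸ 1 → j ≡ 2 × ∃[ t ] j + c ≡ 1 + t * 4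
  pinned⁻′ 1+2^j∣3*2^b∸1
    with j≡2 , t , c≡3+t*4 ← pinned⁺ (1+v∣v*x∸1⇒1+v∣x+1 (2 ^ j) (3 * 2 ^ c) 1≤2^j*[3*2^c]
                               (subst (λ y → 1 + 2 ^ j ∣ y ∸ 1) 3*2^[j+c]≡2^j*[3*2^c] 1+2^j∣3*2^b∸1))
    = j≡2 , suc t , cong₂ _+_ j≡2 c≡3+t*4

pinned : ∀ {j} → 0 < j → ∀ b → Pinned j b
pinned {j} 0<j = <-rec (Pinned j) pinned-below
  where
  pinned-below : ∀ b → (∀ {c} → c < b → Pinned j c) → Pinned j b
  pinned-below b rec with b <? j
  ... | yes b<j = pinned-base b<j
  ... | no  b≮j = subst (Pinned j) (m+[n∸m]≡n j≤b) (pinned-step (rec (∸-monoʳ-< 0<j j≤b)))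
    where
    j≤b : j ≤ b
    j≤b = ≮⇒≥ b≮j

1+2^j∣3*2^b+1⇒j≡2∧b%4≡3 : ∀ {j b} → 0 < j → 1 + 2 ^ j ∣ 3 * 2 ^ b + 1 → j ≡ 2 × b % 4 ≡ 3
1+2^j∣3*2^b+1⇒j≡2∧b%4≡3 {j} {b} 0<j 1+2^j∣3*2^b+1
  with j≡2 , t , refl ← proj₁ (pinned 0<j b) 1+2^j∣3*2^b+1
  = j≡2 , [m+kn]%n≡m%n 3 t 4

omittedPair⇒1+2^j∣3*2^i+1 : ∀ {p i j} → OmittedPairEquation p i j → 1 + 2 ^ j ∣ 3 * 2 ^ i + 1
omittedPair⇒1+2^j∣3*2^i+1 {p} {i} {j} equation =
  ∣m+n∣m⇒∣n (subst (1 + 2 ^ j ∣_) 2^[1+i]*[1+2^j]≡ (n∣m*n (2 * 2 ^ i))) (n∣m*n p)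
  where
  open ≡-Reasoning
  expand : ∀ u v → 2 * u * (1 + v) ≡ 2 * u + 2 * (u * v)
  expand = solve-∀
  regroup : ∀ u v p → 2 * u + (u + v * p + 1 + p) ≡ p * (1 + v) + (3 * u + 1)
  regroup = solve-∀
  2^[1+i]*[1+2^j]≡ : 2 * 2 ^ i * (1 + 2 ^ j) ≡ p * (1 + 2 ^ j) + (3 * 2 ^ i + 1)
  2^[1+i]*[1+2^j]≡ = begin
    2 * 2 ^ i * (1 + 2 ^ j)                  ≡⟨ expand (2 ^ i) (2 ^ j) ⟩
    2 * 2 ^ i + 2 * (2 ^ i * 2 ^ j)          ≡⟨ cong (λ x → 2 * 2 ^ i + 2 * x) (^-distribˡ-+-* 2 i j) ⟨
    2 * 2 ^ i + 2 ^ suc (i + j)              ≡⟨ cong (2 * 2 ^ i +_) equation ⟨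
    2 * 2 ^ i + (2 ^ i + 2 ^ j * p + 1 + p)  ≡⟨ regroup (2 ^ i) (2 ^ j) p ⟩
    p * (1 + 2 ^ j) + (3 * 2 ^ i + 1)        ∎

omittedPair⇒j≡2∧i%4≡3 : ∀ {p} i j → 0 < p → OmittedPairEquation p i j → j ≡ 2 × i % 4 ≡ 3
omittedPair⇒j≡2∧i%4≡3 {p} i (suc j) _ equation =
  1+2^j∣3*2^b+1⇒j≡2∧b%4≡3 {suc j} {i} (s≤s z≤n) (omittedPair⇒1+2^j∣3*2^i+1 {p} {i} {suc j} equation)
omittedPair⇒j≡2∧i%4≡3 {p} (suc i) zero _ equation
  with divides q 6*2^i+1≡q*2 ← omittedPair⇒1+2^j∣3*2^i+1 {p} {suc i} {zero} equation
  = contradiction (begin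
      2 * q                  ≡⟨ *-comm 2 q ⟩
      q * 2                  ≡⟨ 6*2^i+1≡q*2 ⟨
      3 * (2 * 2 ^ i) + 1    ≡⟨ +-comm _ 1 ⟩
      1 + 3 * (2 * 2 ^ i)    ≡⟨ cong suc (x∙yz≈y∙xz 3 2 (2 ^ i)) ⟩
      1 + 2 * (3 * 2 ^ i)    ∎)
    (even≢odd q (3 * 2 ^ i))
  where open ≡-Reasoning
omittedPair⇒j≡2∧i%4≡3 {suc p} zero zero _ equation =
  contradiction (suc-injective (suc-injective equation)) (m+1+n≢0 _)

x≡m∸n∸1⇒x+n+1≡m : ∀ {x m n} → n < m → x ≡ m ∸ n ∸ 1 → x + n + 1 ≡ m
x≡m∸n∸1⇒x+n+1≡m {_} {m} {n} n<m refl = begin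
  m ∸ n ∸ 1 + n + 1      ≡⟨ +-assoc (m ∸ n ∸ 1) n 1 ⟩
  m ∸ n ∸ 1 + (n + 1)    ≡⟨ cong (_+ (n + 1)) (∸-+-assoc m n 1) ⟩
  m ∸ (n + 1) + (n + 1)  ≡⟨ m∸n+n≡m (subst (_≤ m) (+-comm 1 n) n<m) ⟩
  m                      ∎
  where open ≡-Reasoning

x+n+1≡m⇒x≡m∸n∸1 : ∀ {x m n} → x + n + 1 ≡ m → x ≡ m ∸ n ∸ 1
x+n+1≡m⇒x≡m∸n∸1 {x} {_} {n} refl = sym (begin
  x + n + 1 ∸ n ∸ 1      ≡⟨ ∸-+-assoc (x + n + 1) n 1 ⟩
  x + n + 1 ∸ (n + 1)    ≡⟨ cong (_∸ (n + 1)) (+-assoc x n 1) ⟩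
  x + (n + 1) ∸ (n + 1)  ≡⟨ m+n∸n≡m x (n + 1) ⟩
  x                      ∎)
  where open ≡-Reasoning

omitted⇒σ≡2n+x+y : ∀ {n d e x y} → OmittedDivisors n d e →
  (d ≡ x × e ≡ y) ⊎ (d ≡ y × e ≡ x) → σ n ≡ 2 * n + x + y
omitted⇒σ≡2n+x+y     (_ , _ , σ≡2n+d+e) (inj₁ (refl , refl)) = σ≡2n+d+e
omitted⇒σ≡2n+x+y {n} (_ , _ , σ≡2n+d+e) (inj₂ (refl , refl)) = trans σ≡2n+d+e (swap (2 * n) _ _)
  where
  swap : ∀ m x y → m + x + y ≡ m + y + x
  swap = solve-∀

p*[1+2^[k∸a]]≡2^[k+1]∸2^a∸1⇒omittedPair : ∀ {k p a} → a ≤ k →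
  p * (1 + 2 ^ (k ∸ a)) ≡ 2 ^ (k + 1) ∸ 2 ^ a ∸ 1 → OmittedPairEquation p a (k ∸ a)
p*[1+2^[k∸a]]≡2^[k+1]∸2^a∸1⇒omittedPair {k} {p} {a} a≤k p*[1+2^[k∸a]]≡ = begin
  2 ^ a + 2 ^ (k ∸ a) * p + 1 + p    ≡⟨ regroup (2 ^ a) (2 ^ (k ∸ a)) p ⟩
  p * (1 + 2 ^ (k ∸ a)) + 2 ^ a + 1  ≡⟨ x≡m∸n∸1⇒x+n+1≡m 2^a<2^[k+1] p*[1+2^[k∸a]]≡ ⟩
  2 ^ (k + 1)                        ≡⟨ cong (2 ^_) (+-comm k 1) ⟩
  2 ^ suc k                          ≡⟨ cong (λ m → 2 ^ suc m) (m+[n∸m]≡n a≤k) ⟨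
  2 ^ suc (a + (k ∸ a))              ∎
  where
  open ≡-Reasoning
  regroup : ∀ u v p → u + v * p + 1 + p ≡ p * (1 + v) + u + 1
  regroup = solve-∀
  2^a<2^[k+1] : 2 ^ a < 2 ^ (k + 1)
  2^a<2^[k+1] = ^-monoʳ-< 2 (s≤s (s≤s z≤n)) (subst (a <_) (+-comm 1 k) (s≤s a≤k))

omittedPair[j≡2]⇒5*p≡ : ∀ {p a} → OmittedPairEquation p a 2 → 5 * p ≡ 2 ^ (a + 3) ∸ 2 ^ a ∸ 1
omittedPair[j≡2]⇒5*p≡ {p} {a} equation = x+n+1≡m⇒x≡m∸n∸1 (begin
  5 * p + 2 ^ a + 1      ≡⟨ regroup (2 ^ a) p ⟩
  2 ^ a + 4 * p + 1 + p  ≡⟨ equation ⟩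
  2 ^ suc (a + 2)        ≡⟨ cong (2 ^_) (+-suc a 2) ⟨
  2 ^ (a + 3)            ∎)
  where
  open ≡-Reasoning
  regroup : ∀ u p → 5 * p + u + 1 ≡ u + 4 * p + 1 + p
  regroup = solve-∀

proposition16 : ∀ (k p a : ℕ) → Prime p → p % 2 ≡ 1
    → Strongly2NearPerfect (2 ^ k * p)
    → a ≤ k
    → p * (1 + 2 ^ (k ∸ a)) ≡ 2 ^ (k + 1) ∸ 2 ^ a ∸ 1
    → (k ≡ a + 2)
      × (∀ d e → OmittedDivisors (2 ^ k * p) d e
           → (d ≡ 2 ^ a × e ≡ 4 * p) ⊎ (d ≡ 4 * p × e ≡ 2 ^ a))
      × (σ (2 ^ k * p) ≡ 2 * (2 ^ k * p) + 2 ^ a + 4 * p)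
      × (5 * p ≡ 2 ^ (a + 3) ∸ 2 ^ a ∸ 1)
      × (a % 4 ≡ 3)
proposition16 k p a p-prime p-odd (d₀ , e₀ , omitted₀) a≤k p*[1+2^[k∸a]]≡
  = k≡a+2
  , omitted≡
  , omitted⇒σ≡2n+x+y omitted₀ (omitted≡ d₀ e₀ omitted₀)
  , omittedPair[j≡2]⇒5*p≡ {p} {a} (subst (OmittedPairEquation p a) k∸a≡2 equationₐ)
  , a%4≡3
  where
  p≢2 : p ≢ 2
  p≢2 p≡2 = 0≢1+n (trans (cong (_% 2) (sym p≡2)) p-odd)
  0<p : 0 < p
  0<p = >-nonZero⁻¹ p {{prime⇒nonZero p-prime}}

  equationₐ : OmittedPairEquation p a (k ∸ a)
  equationₐ = p*[1+2^[k∸a]]≡2^[k+1]∸2^a∸1⇒omittedPair a≤k p*[1+2^[k∸a]]≡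
  k∸a≡2 : k ∸ a ≡ 2
  k∸a≡2 = proj₁ (omittedPair⇒j≡2∧i%4≡3 a (k ∸ a) 0<p equationₐ)
  a%4≡3 : a % 4 ≡ 3
  a%4≡3 = proj₂ (omittedPair⇒j≡2∧i%4≡3 a (k ∸ a) 0<p equationₐ)
  k≡a+2 : k ≡ a + 2
  k≡a+2 = trans (sym (m+[n∸m]≡n a≤k)) (cong (a +_) k∸a≡2)

  omitted≡ : ∀ d e → OmittedDivisors (2 ^ k * p) d e → (d ≡ 2 ^ a × e ≡ 4 * p) ⊎ (d ≡ 4 * p × e ≡ 2 ^ a)
  omitted≡ d e omitted
    with i , j , i+j≡k , equation , shape ← omitted⇒omittedPair {k} {p} p-prime p≢2 omitted
    with refl ← proj₁ (omittedPair⇒j≡2∧i%4≡3 i j 0<p equation)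
    with refl ← +-cancelʳ-≡ 2 i a (trans i+j≡k k≡a+2)
    = shape
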